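{- Let $k\geq 2$ be an integer. The polynomials $\sum_{i=0}^{k-2}(i+1)x^i$ and $x^k+x^{k-1}+\cdots+x^2+x-1$ are relatively prime, and the polynomials $\sum_{i=0}^{k-2}(2i+2)x^i+\sum_{i=k-1}^{2k-2}(2k-i-1)x^i$ and $x^k+x^{k-1}+\cdots+x^2+x-1$ are relatively prime.
   Context: Polynomials with rational coefficients; relatively prime means having no common nonconstant factor. -}

module Defs where

open import Data.Nat as ℕ using (ℕ; zero; suc; _∸_; _<_; _≤_)
open import Data.Integer using (+_)
open import Data.Rational using (ℚ; 0ℚ; 1ℚ; _+_; _*_; -_; _/_)
open import Data.List using (List; []; _∷_; map; replicate; upTo)
open import Data.Product using (Σ; ∃; _×_)
open import Data.Empty using (⊥)
open import Relation.Nullary using (¬_)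
open import Relation.Binary.PropositionalEquality using (_≡_)

-- Polynomials in one variable x over ℚ, as coefficient lists
-- (constant coefficient first).  Trailing zeros are allowed; equality
-- of polynomials is equality of all coefficients (see _≈ₚ_).
Poly : Set
Poly = List ℚ

coeff : Poly → ℕ → ℚ
coeff []       _       = 0ℚ
coeff (a ∷ p)  zero    = a
coeff (a ∷ p)  (suc n) = coeff p n

_≈ₚ_ : Poly → Poly → Set
p ≈ₚ q = ∀ n → coeff p n ≡ coeff q n

infixl 6 _+ₚ_
infixl 7 _*ₚ_

_+ₚ_ : Poly → Poly → Poly
[]      +ₚ q       = q
(a ∷ p) +ₚ []      = a ∷ p
(a ∷ p) +ₚ (b ∷ q) = (a + b) ∷ (p +ₚ q)

scale : ℚ → Poly → Poly
scale c = map (c *_)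

_*ₚ_ : Poly → Poly → Poly
[]      *ₚ q = []
(a ∷ p) *ₚ q = scale a q +ₚ (0ℚ ∷ (p *ₚ q))

shift : ℕ → Poly → Poly
shift zero    p = p
shift (suc m) p = 0ℚ ∷ shift m p

_∣ₚ_ : Poly → Poly → Set
d ∣ₚ p = Σ Poly λ q → (d *ₚ q) ≈ₚ p

NonConstant : Poly → Set
NonConstant d = ∃ λ n → (1 ℕ.≤ n) × ¬ (coeff d n ≡ 0ℚ)

RelPrime : Poly → Poly → Set
RelPrime p q = ∀ d → NonConstant d → d ∣ₚ p → d ∣ₚ q → ⊥

ℕ→ℚ : ℕ → ℚ
ℕ→ℚ n = + n / 1

polyA : ℕ → Poly
polyA k = map (λ i → ℕ→ℚ (suc i)) (upTo (k ∸ 1))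

-- Σ_{i=0}^{k-2} (2i+2) x^i + Σ_{i=k-1}^{2k-2} (2k-i-1) x^i
-- (second sum reindexed by i = (k-1)+j, j = 0..k-1)
polyB : ℕ → Poly
polyB k = map (λ i → ℕ→ℚ (2 ℕ.* i ℕ.+ 2)) (upTo (k ∸ 1))
       +ₚ shift (k ∸ 1)
            (map (λ j → ℕ→ℚ (2 ℕ.* k ∸ ((k ∸ 1) ℕ.+ j) ∸ 1)) (upTo k))

polyC : ℕ → Poly
polyC k = (- 1ℚ) ∷ replicate k 1ℚ

-- For P = A and P = B there are explicit polynomials with
--   x²(x − 1)·P + v·C = −a + b·x,
-- namely (a, b) = (k, 2k − 1) for A and (k + 1, 2k) for B; they are checked after
-- multiplying by x − 1, using the closed forms of the arithmetico-geometric sums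
-- (x − 1)²·P and of (x − 1)·C = x^(k+1) − 2x + 1.  A nonconstant common factor d
-- of P and C thus divides −a + b·x, so d, and with it C, vanishes at a/b.  But
-- C(a/b) = 0 says a^(k+1) + b^(k+1) = 2ab^k, and this is impossible because k
-- divides one of a, b and is coprime to the other.
module Submission where

open import Defs
open import Data.Nat using (ℕ; _≤_)
open import Data.Product using (_×_)

open import Function using (_∘_)
open import Data.Nat as ℕ using (zero; suc; _∸_; _<_; z≤n; s≤s)
import Data.Nat.Properties as ℕₚ
import Data.Nat.Tactic.RingSolver as ℕ-Solver
open import Data.Nat.Divisibility
  using (_∣_; ∣-refl; ∣-trans; ∣1⇒≡1; ∣m+n∣m⇒∣n; ∣m∣n⇒∣m+n; m∣m*n; n∣m*n)
open import Data.Nat.Coprimality as Coprime using (Coprime; coprime-divisor; coprime-+; 1-coprimeTo)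
import Data.Integer as ℤ
import Data.Integer.Properties as ℤ
import Data.Integer.Tactic.RingSolver as ℤ-Solver
open import Data.Rational using (ℚ; 0ℚ; 1ℚ; _+_; _*_; -_; _-_; 1/_; toℚᵘ; ≢-nonZero)
open import Data.Rational.Properties
  using ( _≟_; +-*-commutativeRing; +-0-group; +-identityˡ; +-identityʳ; *-zeroˡ; *-zeroʳ
        ; +-inverseˡ; +-inverseʳ; *-identityˡ; *-identityʳ; +-comm; *-assoc; *-comm; *-inverseˡ
        ; toℚᵘ-injective; toℚᵘ-fromℚᵘ; toℚᵘ-homo-+; toℚᵘ-homo-*; toℚᵘ-cong )
open import Data.Rational.Unnormalised as ℚᵘ using (mkℚᵘ; *≡*)
import Data.Rational.Unnormalised.Properties as ℚᵘ
open import Algebra.Properties.Group +-0-group using (x∙y⁻¹≈ε⇒x≈y)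
open import Data.List using ([]; _∷_; length; map; replicate; upTo; applyUpTo)
open import Data.List.Properties using (map-upTo)
open import Data.Product using (∃-syntax; _,_)
open import Data.Sum using (_⊎_; inj₁; inj₂)
open import Data.Empty using (⊥-elim)
open import Relation.Nullary using (¬_; yes; no)
open import Relation.Nullary.Decidable.Core using (dec⇒maybe)
open import Relation.Binary.PropositionalEquality
open import Tactic.RingSolver using (solve-∀; solve)
open import Tactic.RingSolver.Core.AlmostCommutativeRing
  using (AlmostCommutativeRing; fromCommutativeRing)

ℚ-ring : AlmostCommutativeRing _ _
ℚ-ring = fromCommutativeRing +-*-commutativeRing (λ x → dec⇒maybe (0ℚ ≟ x))

infixr 8 _^_

_^_ : ℚ → ℕ → ℚ
x ^ zero  = 1ℚ
x ^ suc n = x * x ^ n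

^-distribʳ-* : ∀ x y n → (x * y) ^ n ≡ x ^ n * y ^ n
^-distribʳ-* x y zero    = refl
^-distribʳ-* x y (suc n) =
  trans (cong (x * y *_) (^-distribʳ-* x y n)) (regroup x y (x ^ n) (y ^ n))
  where
  regroup : ∀ x y p q → x * y * (p * q) ≡ x * p * (y * q)
  regroup = solve-∀ ℚ-ring

x-y≡0⇒x≡y : ∀ {x y} → x - y ≡ 0ℚ → x ≡ y
x-y≡0⇒x≡y = x∙y⁻¹≈ε⇒x≈y _ _

x*y≡0⇒y≡0 : ∀ {x y} → x ≢ 0ℚ → x * y ≡ 0ℚ → y ≡ 0ℚ
x*y≡0⇒y≡0 {x} {y} x≢0 xy≡0 = begin
  y              ≡⟨ sym (*-identityˡ y) ⟩
  1ℚ * y         ≡⟨ cong (_* y) (sym (*-inverseˡ x)) ⟩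
  1/ x * x * y   ≡⟨ *-assoc (1/ x) x y ⟩
  1/ x * (x * y) ≡⟨ cong (1/ x *_) xy≡0 ⟩
  1/ x * 0ℚ      ≡⟨ *-zeroʳ (1/ x) ⟩
  0ℚ             ∎
  where
  open ≡-Reasoning
  instance _ = ≢-nonZero x≢0

*-cancelˡ-≢0 : ∀ {x y z} → x ≢ 0ℚ → x * y ≡ x * z → y ≡ z
*-cancelˡ-≢0 {x} {y} {z} x≢0 xy≡xz = x-y≡0⇒x≡y (x*y≡0⇒y≡0 x≢0 (begin
  x * (y - z)     ≡⟨ distrib x y z ⟩
  x * y - x * z   ≡⟨ cong (_- x * z) xy≡xz ⟩
  x * z - x * z   ≡⟨ +-inverseʳ (x * z) ⟩
  0ℚ              ∎))
  where
  open ≡-Reasoning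
  distrib : ∀ x y z → x * (y - z) ≡ x * y - x * z
  distrib = solve-∀ ℚ-ring

toℚᵘ-ℕ→ℚ : ∀ n → toℚᵘ (ℕ→ℚ n) ℚᵘ.≃ mkℚᵘ (ℤ.+ n) 0
toℚᵘ-ℕ→ℚ n = toℚᵘ-fromℚᵘ (mkℚᵘ (ℤ.+ n) 0)

ℕ→ℚ-+ : ∀ m n → ℕ→ℚ (m ℕ.+ n) ≡ ℕ→ℚ m + ℕ→ℚ n
ℕ→ℚ-+ m n = toℚᵘ-injective (begin
  toℚᵘ (ℕ→ℚ (m ℕ.+ n))                  ≈⟨ toℚᵘ-ℕ→ℚ (m ℕ.+ n) ⟩
  mkℚᵘ (ℤ.+ (m ℕ.+ n)) 0                ≈⟨ *≡* (cross-multiplied (ℤ.+ m) (ℤ.+ n)) ⟩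
  mkℚᵘ (ℤ.+ m) 0 ℚᵘ.+ mkℚᵘ (ℤ.+ n) 0    ≈⟨ ℚᵘ.+-cong (toℚᵘ-ℕ→ℚ m) (toℚᵘ-ℕ→ℚ n) ⟨
  toℚᵘ (ℕ→ℚ m) ℚᵘ.+ toℚᵘ (ℕ→ℚ n)        ≈⟨ toℚᵘ-homo-+ (ℕ→ℚ m) (ℕ→ℚ n) ⟨
  toℚᵘ (ℕ→ℚ m + ℕ→ℚ n)                  ∎)
  where
  open ℚᵘ.≃-Reasoning
  cross-multiplied : ∀ i j →
    (i ℤ.+ j) ℤ.* (ℤ.+ 1 ℤ.* ℤ.+ 1) ≡ (i ℤ.* ℤ.+ 1 ℤ.+ j ℤ.* ℤ.+ 1) ℤ.* ℤ.+ 1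
  cross-multiplied = ℤ-Solver.solve-∀

ℕ→ℚ-* : ∀ m n → ℕ→ℚ (m ℕ.* n) ≡ ℕ→ℚ m * ℕ→ℚ n
ℕ→ℚ-* m n = toℚᵘ-injective (begin
  toℚᵘ (ℕ→ℚ (m ℕ.* n))                  ≈⟨ toℚᵘ-ℕ→ℚ (m ℕ.* n) ⟩
  mkℚᵘ (ℤ.+ (m ℕ.* n)) 0                ≈⟨ *≡* cross-multiplied ⟩
  mkℚᵘ (ℤ.+ m) 0 ℚᵘ.* mkℚᵘ (ℤ.+ n) 0    ≈⟨ ℚᵘ.*-cong (toℚᵘ-ℕ→ℚ m) (toℚᵘ-ℕ→ℚ n) ⟨
  toℚᵘ (ℕ→ℚ m) ℚᵘ.* toℚᵘ (ℕ→ℚ n)        ≈⟨ toℚᵘ-homo-* (ℕ→ℚ m) (ℕ→ℚ n) ⟨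
  toℚᵘ (ℕ→ℚ m * ℕ→ℚ n)                  ∎)
  where
  open ℚᵘ.≃-Reasoning
  regroup : ∀ i j → (i ℤ.* j) ℤ.* (ℤ.+ 1 ℤ.* ℤ.+ 1) ≡ (i ℤ.* j) ℤ.* ℤ.+ 1
  regroup = ℤ-Solver.solve-∀
  cross-multiplied : ℤ.+ (m ℕ.* n) ℤ.* (ℤ.+ 1 ℤ.* ℤ.+ 1) ≡ (ℤ.+ m ℤ.* ℤ.+ n) ℤ.* ℤ.+ 1
  cross-multiplied = trans (cong (ℤ._* (ℤ.+ 1 ℤ.* ℤ.+ 1)) (ℤ.pos-* m n)) (regroup (ℤ.+ m) (ℤ.+ n))

ℕ→ℚ-suc : ∀ n → ℕ→ℚ (suc n) ≡ 1ℚ + ℕ→ℚ n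
ℕ→ℚ-suc = ℕ→ℚ-+ 1

ℕ→ℚ-^ : ∀ m n → ℕ→ℚ (m ℕ.^ n) ≡ ℕ→ℚ m ^ n
ℕ→ℚ-^ m zero    = refl
ℕ→ℚ-^ m (suc n) = trans (ℕ→ℚ-* m (m ℕ.^ n)) (cong (ℕ→ℚ m *_) (ℕ→ℚ-^ m n))

ℕ→ℚ-∸ : ∀ {m n} → n ≤ m → ℕ→ℚ (m ∸ n) ≡ ℕ→ℚ m - ℕ→ℚ n
ℕ→ℚ-∸ {m} {n} n≤m = begin
  ℕ→ℚ (m ∸ n)                         ≡⟨ cancel (ℕ→ℚ (m ∸ n)) (ℕ→ℚ n) ⟩
  ℕ→ℚ (m ∸ n) + ℕ→ℚ n - ℕ→ℚ n         ≡⟨ cong (_- ℕ→ℚ n) (sym (ℕ→ℚ-+ (m ∸ n) n)) ⟩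
  ℕ→ℚ (m ∸ n ℕ.+ n) - ℕ→ℚ n           ≡⟨ cong (λ t → ℕ→ℚ t - ℕ→ℚ n) (ℕₚ.m∸n+n≡m n≤m) ⟩
  ℕ→ℚ m - ℕ→ℚ n                       ∎
  where
  open ≡-Reasoning
  cancel : ∀ p q → p ≡ p + q - q
  cancel = solve-∀ ℚ-ring

ℕ→ℚ-injective : ∀ {m n} → ℕ→ℚ m ≡ ℕ→ℚ n → m ≡ n
ℕ→ℚ-injective {m} {n} eq
  with ℚᵘ.≃-trans (ℚᵘ.≃-sym (toℚᵘ-ℕ→ℚ m)) (ℚᵘ.≃-trans (toℚᵘ-cong eq) (toℚᵘ-ℕ→ℚ n))
... | *≡* m*1≡n*1 =
  ℤ.+-injective (trans (sym (ℤ.*-identityʳ (ℤ.+ m))) (trans m*1≡n*1 (ℤ.*-identityʳ (ℤ.+ n))))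

eval : Poly → ℚ → ℚ
eval []      x = 0ℚ
eval (a ∷ p) x = a + x * eval p x

eval-+ₚ : ∀ p q x → eval (p +ₚ q) x ≡ eval p x + eval q x
eval-+ₚ []      q       x = sym (+-identityˡ _)
eval-+ₚ (a ∷ p) []      x = sym (+-identityʳ _)
eval-+ₚ (a ∷ p) (b ∷ q) x =
  trans (cong (λ e → a + b + x * e) (eval-+ₚ p q x)) (regroup a b x (eval p x) (eval q x))
  where
  regroup : ∀ a b x P Q → a + b + x * (P + Q) ≡ a + x * P + (b + x * Q)
  regroup = solve-∀ ℚ-ring

eval-scale : ∀ c p x → eval (scale c p) x ≡ c * eval p x
eval-scale c []      x = sym (*-zeroʳ c)
eval-scale c (a ∷ p) x =
  trans (cong (λ e → c * a + x * e) (eval-scale c p x)) (regroup c a x (eval p x))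
  where
  regroup : ∀ c a x P → c * a + x * (c * P) ≡ c * (a + x * P)
  regroup = solve-∀ ℚ-ring

eval-*ₚ : ∀ p q x → eval (p *ₚ q) x ≡ eval p x * eval q x
eval-*ₚ []      q x = sym (*-zeroˡ (eval q x))
eval-*ₚ (a ∷ p) q x = begin
  eval (scale a q +ₚ (0ℚ ∷ p *ₚ q)) x       ≡⟨ eval-+ₚ (scale a q) (0ℚ ∷ p *ₚ q) x ⟩
  eval (scale a q) x + (0ℚ + x * eval (p *ₚ q) x)
    ≡⟨ cong₂ (λ s e → s + (0ℚ + x * e)) (eval-scale a q x) (eval-*ₚ p q x) ⟩
  a * eval q x + (0ℚ + x * (eval p x * eval q x))
    ≡⟨ regroup a x (eval p x) (eval q x) ⟩
  (a + x * eval p x) * eval q x             ∎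
  where
  open ≡-Reasoning
  regroup : ∀ a x P Q → a * Q + (0ℚ + x * (P * Q)) ≡ (a + x * P) * Q
  regroup = solve-∀ ℚ-ring

eval-shift : ∀ m p x → eval (shift m p) x ≡ x ^ m * eval p x
eval-shift zero    p x = sym (*-identityˡ _)
eval-shift (suc m) p x =
  trans (cong (λ e → 0ℚ + x * e) (eval-shift m p x)) (regroup x (x ^ m) (eval p x))
  where
  regroup : ∀ x y P → 0ℚ + x * (y * P) ≡ x * y * P
  regroup = solve-∀ ℚ-ring

eval-≈ₚ[] : ∀ p x → p ≈ₚ [] → eval p x ≡ 0ℚ
eval-≈ₚ[] []      x p≈[] = refl
eval-≈ₚ[] (a ∷ p) x p≈[] =
  trans (cong₂ (λ a e → a + x * e) (p≈[] 0) (eval-≈ₚ[] p x (p≈[] ∘ suc))) (vanish x)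
  where
  vanish : ∀ x → 0ℚ + x * 0ℚ ≡ 0ℚ
  vanish = solve-∀ ℚ-ring

eval-cong : ∀ p q x → p ≈ₚ q → eval p x ≡ eval q x
eval-cong []      q       x p≈q = sym (eval-≈ₚ[] q x (sym ∘ p≈q))
eval-cong (a ∷ p) []      x p≈q = eval-≈ₚ[] (a ∷ p) x p≈q
eval-cong (a ∷ p) (b ∷ q) x p≈q = cong₂ (λ a e → a + x * e) (p≈q 0) (eval-cong p q x (p≈q ∘ suc))

eval-factorisation : ∀ d s r x → (d *ₚ s) ≈ₚ r → eval d x * eval s x ≡ eval r x
eval-factorisation d s r x ds≈r = trans (sym (eval-*ₚ d s x)) (eval-cong (d *ₚ s) r x ds≈r)

coeff-+ₚ : ∀ p q n → coeff (p +ₚ q) n ≡ coeff p n + coeff q n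
coeff-+ₚ []      q       n       = sym (+-identityˡ _)
coeff-+ₚ (a ∷ p) []      n       = sym (+-identityʳ _)
coeff-+ₚ (a ∷ p) (b ∷ q) zero    = refl
coeff-+ₚ (a ∷ p) (b ∷ q) (suc n) = coeff-+ₚ p q n

coeff-scale : ∀ c p n → coeff (scale c p) n ≡ c * coeff p n
coeff-scale c []      n       = sym (*-zeroʳ c)
coeff-scale c (a ∷ p) zero    = refl
coeff-scale c (a ∷ p) (suc n) = coeff-scale c p n

coeff-∷-*ₚ : ∀ a p q n → coeff ((a ∷ p) *ₚ q) n ≡ a * coeff q n + coeff (0ℚ ∷ p *ₚ q) n
coeff-∷-*ₚ a p q n =
  trans (coeff-+ₚ (scale a q) (0ℚ ∷ p *ₚ q) n) (cong (_+ _) (coeff-scale a q n))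

-- The identity principle

syntheticDiv : ℚ → Poly → Poly
syntheticDiv c []      = []
syntheticDiv c (b ∷ p) = eval (b ∷ p) c ∷ syntheticDiv c p

length-syntheticDiv : ∀ c p → length (syntheticDiv c p) ≡ length p
length-syntheticDiv c []      = refl
length-syntheticDiv c (b ∷ p) = cong suc (length-syntheticDiv c p)

eval-syntheticDiv : ∀ a p c x →
  eval (a ∷ p) x ≡ (x - c) * eval (syntheticDiv c p) x + eval (a ∷ p) c
eval-syntheticDiv a []      c x = base a c x
  where
  base : ∀ a c x → a + x * 0ℚ ≡ (x - c) * 0ℚ + (a + c * 0ℚ)
  base = solve-∀ ℚ-ring
eval-syntheticDiv a (b ∷ p) c x =
  trans (cong (λ e → a + x * e) (eval-syntheticDiv b p c x))
        (regroup a x c (eval (syntheticDiv c p) x) (eval (b ∷ p) c))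
  where
  regroup : ∀ a x c Q V → a + x * ((x - c) * Q + V) ≡ (x - c) * (V + x * Q) + (a + c * V)
  regroup = solve-∀ ℚ-ring

coeff₀-syntheticDiv : ∀ c p → coeff (syntheticDiv c p) 0 ≡ eval p c
coeff₀-syntheticDiv c []      = refl
coeff₀-syntheticDiv c (b ∷ p) = refl

coeff-syntheticDiv : ∀ p c n →
  coeff p n ≡ coeff (syntheticDiv c p) n - c * coeff (syntheticDiv c p) (suc n)
coeff-syntheticDiv []      c n       = vanish c
  where
  vanish : ∀ c → 0ℚ ≡ 0ℚ - c * 0ℚ
  vanish = solve-∀ ℚ-ring
coeff-syntheticDiv (b ∷ p) c zero    =
  trans (cancel b c (eval p c)) (cong (λ e → b + c * eval p c - c * e) (sym (coeff₀-syntheticDiv c p)))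
  where
  cancel : ∀ b c e → b ≡ b + c * e - c * e
  cancel = solve-∀ ℚ-ring
coeff-syntheticDiv (b ∷ p) c (suc n) = coeff-syntheticDiv p c n

syntheticDiv-≈ₚ[] : ∀ a p c → syntheticDiv c p ≈ₚ [] → eval (a ∷ p) c ≡ 0ℚ → (a ∷ p) ≈ₚ []
syntheticDiv-≈ₚ[] a p c q≈[] root zero = begin
  a                ≡⟨ sym (+-identityʳ a) ⟩
  a + 0ℚ           ≡⟨ cong (a +_) (sym (*-zeroʳ c)) ⟩
  a + c * 0ℚ       ≡⟨ cong (λ e → a + c * e) (trans (sym (q≈[] 0)) (coeff₀-syntheticDiv c p)) ⟩
  a + c * eval p c ≡⟨ root ⟩
  0ℚ               ∎
  where open ≡-Reasoning
syntheticDiv-≈ₚ[] a p c q≈[] root (suc n) = begin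
  coeff p n
    ≡⟨ coeff-syntheticDiv p c n ⟩
  coeff (syntheticDiv c p) n - c * coeff (syntheticDiv c p) (suc n)
    ≡⟨ cong₂ (λ u v → u - c * v) (q≈[] n) (q≈[] (suc n)) ⟩
  0ℚ - c * 0ℚ
    ≡⟨ vanish c ⟩
  0ℚ ∎
  where
  open ≡-Reasoning
  vanish : ∀ c → 0ℚ - c * 0ℚ ≡ 0ℚ
  vanish = solve-∀ ℚ-ring

ℕ→ℚ-1+m+n≢m : ∀ c n → ℕ→ℚ (suc c ℕ.+ n) ≢ ℕ→ℚ c
ℕ→ℚ-1+m+n≢m c n eq = ℕₚ.m≢1+m+n c (sym (ℕ→ℚ-injective eq))

vanishes-from⇒≈ₚ[] : ∀ N p c → length p ≤ N →
  (∀ n → eval p (ℕ→ℚ (c ℕ.+ n)) ≡ 0ℚ) → p ≈ₚ []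
vanishes-from⇒≈ₚ[] N       []      c _         _      = λ _ → refl
vanishes-from⇒≈ₚ[] (suc N) (a ∷ p) c (s≤s |p|≤N) vanish =
  syntheticDiv-≈ₚ[] a p (ℕ→ℚ c) quotient≈[] root
  where
  root : eval (a ∷ p) (ℕ→ℚ c) ≡ 0ℚ
  root = subst (λ m → eval (a ∷ p) (ℕ→ℚ m) ≡ 0ℚ) (ℕₚ.+-identityʳ c) (vanish 0)
  quotient-vanishes : ∀ n → eval (syntheticDiv (ℕ→ℚ c) p) (ℕ→ℚ (suc c ℕ.+ n)) ≡ 0ℚ
  quotient-vanishes n = x*y≡0⇒y≡0 (ℕ→ℚ-1+m+n≢m c n ∘ x-y≡0⇒x≡y) (begin
    (x - ℕ→ℚ c) * eval (syntheticDiv (ℕ→ℚ c) p) x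
      ≡⟨ sym (+-identityʳ _) ⟩
    (x - ℕ→ℚ c) * eval (syntheticDiv (ℕ→ℚ c) p) x + 0ℚ
      ≡⟨ cong ((x - ℕ→ℚ c) * eval (syntheticDiv (ℕ→ℚ c) p) x +_) (sym root) ⟩
    (x - ℕ→ℚ c) * eval (syntheticDiv (ℕ→ℚ c) p) x + eval (a ∷ p) (ℕ→ℚ c)
      ≡⟨ sym (eval-syntheticDiv a p (ℕ→ℚ c) x) ⟩
    eval (a ∷ p) x
      ≡⟨ subst (λ m → eval (a ∷ p) (ℕ→ℚ m) ≡ 0ℚ) (ℕₚ.+-suc c n) (vanish (suc n)) ⟩
    0ℚ ∎)
    where
    open ≡-Reasoning
    x = ℕ→ℚ (suc c ℕ.+ n)
  quotient≈[] : syntheticDiv (ℕ→ℚ c) p ≈ₚ []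
  quotient≈[] = vanishes-from⇒≈ₚ[] N (syntheticDiv (ℕ→ℚ c) p) (suc c)
    (subst (ℕ._≤ N) (sym (length-syntheticDiv (ℕ→ℚ c) p)) |p|≤N) quotient-vanishes

eval-agrees-from⇒≈ₚ : ∀ c p q →
  (∀ n → eval p (ℕ→ℚ (c ℕ.+ n)) ≡ eval q (ℕ→ℚ (c ℕ.+ n))) → p ≈ₚ q
eval-agrees-from⇒≈ₚ c p q agree n = x-y≡0⇒x≡y (begin
  coeff p n - coeff q n                 ≡⟨ minus-one (coeff p n) (coeff q n) ⟩
  coeff p n + - 1ℚ * coeff q n          ≡⟨ cong (coeff p n +_) (sym (coeff-scale (- 1ℚ) q n)) ⟩
  coeff p n + coeff (scale (- 1ℚ) q) n  ≡⟨ sym (coeff-+ₚ p (scale (- 1ℚ) q) n) ⟩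
  coeff (p +ₚ scale (- 1ℚ) q) n         ≡⟨ difference≈[] n ⟩
  0ℚ                                    ∎)
  where
  open ≡-Reasoning
  minus-one : ∀ u v → u - v ≡ u + - 1ℚ * v
  minus-one = solve-∀ ℚ-ring
  difference≈[] : (p +ₚ scale (- 1ℚ) q) ≈ₚ []
  difference≈[] = vanishes-from⇒≈ₚ[] _ (p +ₚ scale (- 1ℚ) q) c ℕₚ.≤-refl λ m →
    let x = ℕ→ℚ (c ℕ.+ m) in begin
      eval (p +ₚ scale (- 1ℚ) q) x        ≡⟨ eval-+ₚ p (scale (- 1ℚ) q) x ⟩
      eval p x + eval (scale (- 1ℚ) q) x  ≡⟨ cong₂ _+_ (agree m) (eval-scale (- 1ℚ) q x) ⟩
      eval q x + - 1ℚ * eval q x          ≡⟨ sym (minus-one (eval q x) (eval q x)) ⟩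
      eval q x - eval q x                 ≡⟨ +-inverseʳ (eval q x) ⟩
      0ℚ                                  ∎

HasDegree : Poly → ℕ → Set
HasDegree p t = coeff p t ≢ 0ℚ × (∀ n → t < n → coeff p n ≡ 0ℚ)

≈ₚ[]⊎degree : ∀ p → p ≈ₚ [] ⊎ ∃[ t ] HasDegree p t
≈ₚ[]⊎degree []      = inj₁ λ _ → refl
≈ₚ[]⊎degree (a ∷ p) with ≈ₚ[]⊎degree p
... | inj₂ (t , pₜ≢0 , above) = inj₂ (suc t , pₜ≢0 , λ { zero () ; (suc n) (s≤s t<n) → above n t<n })
... | inj₁ p≈[] with a ≟ 0ℚ
...   | yes a≡0 = inj₁ λ { zero → a≡0 ; (suc n) → p≈[] n }
...   | no  a≢0 = inj₂ (0 , a≢0 , λ { zero () ; (suc n) _ → p≈[] n })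

*ₚ-zeroˡ : ∀ p q → p ≈ₚ [] → (p *ₚ q) ≈ₚ []
*ₚ-zeroˡ []      q p≈[] n = refl
*ₚ-zeroˡ (a ∷ p) q p≈[] n = begin
  coeff ((a ∷ p) *ₚ q) n                ≡⟨ coeff-∷-*ₚ a p q n ⟩
  a * coeff q n + coeff (0ℚ ∷ p *ₚ q) n ≡⟨ cong₂ (λ a c → a * coeff q n + c) (p≈[] 0) (tail≈[] n) ⟩
  0ℚ * coeff q n + 0ℚ                   ≡⟨ trans (+-identityʳ _) (*-zeroˡ (coeff q n)) ⟩
  0ℚ                                    ∎
  where
  open ≡-Reasoning
  tail≈[] : (0ℚ ∷ p *ₚ q) ≈ₚ []
  tail≈[] zero    = refl
  tail≈[] (suc n) = *ₚ-zeroˡ p q (p≈[] ∘ suc) n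

coeff-*ₚ-top : ∀ p q s t → (∀ n → s < n → coeff p n ≡ 0ℚ) → (∀ n → t < n → coeff q n ≡ 0ℚ) →
  coeff (p *ₚ q) (s ℕ.+ t) ≡ coeff p s * coeff q t
coeff-*ₚ-top []      q s       t p-top q-top = sym (*-zeroˡ (coeff q t))
coeff-*ₚ-top (a ∷ p) q zero    t p-top q-top =
  trans (coeff-∷-*ₚ a p q t) (trans (cong (a * coeff q t +_) (tail≈[] t)) (+-identityʳ _))
  where
  tail≈[] : (0ℚ ∷ p *ₚ q) ≈ₚ []
  tail≈[] zero    = refl
  tail≈[] (suc n) = *ₚ-zeroˡ p q (λ m → p-top (suc m) (s≤s z≤n)) n
coeff-*ₚ-top (a ∷ p) q (suc s) t p-top q-top = begin
  coeff ((a ∷ p) *ₚ q) (suc s ℕ.+ t)           ≡⟨ coeff-∷-*ₚ a p q (suc s ℕ.+ t) ⟩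
  a * coeff q (suc s ℕ.+ t) + coeff (p *ₚ q) (s ℕ.+ t)
    ≡⟨ cong₂ (λ u v → a * u + v) (q-top _ (s≤s (ℕₚ.m≤n+m t s)))
             (coeff-*ₚ-top p q s t (λ n s<n → p-top (suc n) (s≤s s<n)) q-top) ⟩
  a * 0ℚ + coeff p s * coeff q t               ≡⟨ cong (_+ _) (*-zeroʳ a) ⟩
  0ℚ + coeff p s * coeff q t                   ≡⟨ +-identityˡ _ ⟩
  coeff p s * coeff q t                        ∎
  where open ≡-Reasoning

cofactor-of-linear-constant : ∀ d s l → NonConstant d → (d *ₚ s) ≈ₚ l →
  (∀ n → 2 ≤ n → coeff l n ≡ 0ℚ) → ∀ n → 1 ≤ n → coeff s n ≡ 0ℚ
cofactor-of-linear-constant d s l (m , 1≤m , dₘ≢0) ds≈l l-linear n 1≤n with ≈ₚ[]⊎degree d | ≈ₚ[]⊎degree s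
... | inj₁ d≈[]               | _                         = ⊥-elim (dₘ≢0 (d≈[] m))
... | inj₂ _                  | inj₁ s≈[]                 = s≈[] n
... | inj₂ _                  | inj₂ (zero , _ , s-top)   = s-top n 1≤n
... | inj₂ (t , dₜ≢0 , d-top) | inj₂ (suc u , sᵤ≢0 , s-top) =
  ⊥-elim (sᵤ≢0 (x*y≡0⇒y≡0 dₜ≢0 (begin
    coeff d t * coeff s (suc u)   ≡⟨ sym (coeff-*ₚ-top d s t (suc u) d-top s-top) ⟩
    coeff (d *ₚ s) (t ℕ.+ suc u)  ≡⟨ ds≈l (t ℕ.+ suc u) ⟩
    coeff l (t ℕ.+ suc u)         ≡⟨ l-linear _ (ℕₚ.+-mono-≤ (ℕₚ.≤-trans 1≤m m≤t) (s≤s z≤n)) ⟩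
    0ℚ                            ∎)))
  where
  open ≡-Reasoning
  m≤t : m ≤ t
  m≤t with t ℕ.<? m
  ... | yes t<m = ⊥-elim (dₘ≢0 (d-top m t<m))
  ... | no  t≮m = ℕₚ.≮⇒≥ t≮m

eval-constant : ∀ s x → (∀ n → 1 ≤ n → coeff s n ≡ 0ℚ) → eval s x ≡ coeff s 0
eval-constant []      x _        = refl
eval-constant (a ∷ s) x s-const = begin
  a + x * eval s x ≡⟨ cong (λ e → a + x * e) (eval-≈ₚ[] s x λ n → s-const (suc n) (s≤s z≤n)) ⟩
  a + x * 0ℚ       ≡⟨ cong (a +_) (*-zeroʳ x) ⟩
  a + 0ℚ           ≡⟨ +-identityʳ a ⟩
  a                ∎
  where open ≡-Reasoning

factor-of-linear-vanishes-at-root : ∀ d l β → NonConstant d → d ∣ₚ l →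
  (∀ n → 2 ≤ n → coeff l n ≡ 0ℚ) → ¬ l ≈ₚ [] → eval l β ≡ 0ℚ → eval d β ≡ 0ℚ
factor-of-linear-vanishes-at-root d l β d-nonconstant (s , ds≈l) l-linear l≉[] l[β]≡0 =
  x*y≡0⇒y≡0 s₀≢0 (trans (*-comm s₀ (eval d β)) (trans (factorisation β) l[β]≡0))
  where
  s₀ = coeff s 0
  factorisation : ∀ x → eval d x * s₀ ≡ eval l x
  factorisation x = begin
    eval d x * s₀        ≡⟨ cong (eval d x *_) (sym (eval-constant s x s-constant)) ⟩
    eval d x * eval s x  ≡⟨ eval-factorisation d s l x ds≈l ⟩
    eval l x             ∎
    where
    open ≡-Reasoning
    s-constant = cofactor-of-linear-constant d s l d-nonconstant ds≈l l-linear
  s₀≢0 : s₀ ≢ 0ℚ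
  s₀≢0 s₀≡0 = l≉[] (vanishes-from⇒≈ₚ[] (length l) l 0 ℕₚ.≤-refl λ n →
    trans (sym (factorisation _)) (trans (cong (eval d (ℕ→ℚ n) *_) s₀≡0) (*-zeroʳ (eval d (ℕ→ℚ n)))))

∣ₚ-root : ∀ d q β → d ∣ₚ q → eval d β ≡ 0ℚ → eval q β ≡ 0ℚ
∣ₚ-root d q β (s , ds≈q) d[β]≡0 = begin
  eval q β             ≡⟨ sym (eval-factorisation d s q β ds≈q) ⟩
  eval d β * eval s β  ≡⟨ cong (_* eval s β) d[β]≡0 ⟩
  0ℚ * eval s β        ≡⟨ *-zeroˡ (eval s β) ⟩
  0ℚ                   ∎
  where open ≡-Reasoning

∣ₚ-combination : ∀ d p q u v → d ∣ₚ p → d ∣ₚ q →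
  ∃[ s ] ∀ x → eval (d *ₚ s) x ≡ eval u x * eval p x + eval v x * eval q x
∣ₚ-combination d p q u v (q₁ , dq₁≈p) (q₂ , dq₂≈q) = u *ₚ q₁ +ₚ v *ₚ q₂ , eval-d·s
  where
  eval-d·s : ∀ x → eval (d *ₚ (u *ₚ q₁ +ₚ v *ₚ q₂)) x ≡ eval u x * eval p x + eval v x * eval q x
  eval-d·s x = begin
    eval (d *ₚ (u *ₚ q₁ +ₚ v *ₚ q₂)) x
      ≡⟨ eval-*ₚ d (u *ₚ q₁ +ₚ v *ₚ q₂) x ⟩
    eval d x * eval (u *ₚ q₁ +ₚ v *ₚ q₂) x
      ≡⟨ cong (eval d x *_) (trans (eval-+ₚ (u *ₚ q₁) (v *ₚ q₂) x)
                                    (cong₂ _+_ (eval-*ₚ u q₁ x) (eval-*ₚ v q₂ x))) ⟩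
    eval d x * (eval u x * eval q₁ x + eval v x * eval q₂ x)
      ≡⟨ regroup (eval d x) (eval u x) (eval q₁ x) (eval v x) (eval q₂ x) ⟩
    eval u x * (eval d x * eval q₁ x) + eval v x * (eval d x * eval q₂ x)
      ≡⟨ cong₂ (λ s t → eval u x * s + eval v x * t)
               (eval-factorisation d q₁ p x dq₁≈p) (eval-factorisation d q₂ q x dq₂≈q) ⟩
    eval u x * eval p x + eval v x * eval q x ∎
    where
    open ≡-Reasoning
    regroup : ∀ D U Q₁ V Q₂ → D * (U * Q₁ + V * Q₂) ≡ U * (D * Q₁) + V * (D * Q₂)
    regroup = solve-∀ ℚ-ring

eval-linear : ∀ a b x → eval (a ∷ b ∷ []) x ≡ a + x * b
eval-linear a b x = cong (λ t → a + x * t) (trans (cong (b +_) (*-zeroʳ x)) (+-identityʳ b))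

common-factor-root : ∀ d p q u v a b → NonConstant d → d ∣ₚ p → d ∣ₚ q → b ≢ 0 →
  (∀ x → x ≢ 1ℚ → eval u x * eval p x + eval v x * eval q x ≡ - ℕ→ℚ a + x * ℕ→ℚ b) →
  ∃[ β ] β * ℕ→ℚ b ≡ ℕ→ℚ a × eval q β ≡ 0ℚ
common-factor-root d p q u v a b d-nonconstant d∣p d∣q b≢0 combination =
  β , βB≡A , ∣ₚ-root d q β d∣q d[β]≡0
  where
  A = ℕ→ℚ a
  B = ℕ→ℚ b

  B≢0 : B ≢ 0ℚ
  B≢0 = b≢0 ∘ ℕ→ℚ-injective
  instance _ = ≢-nonZero B≢0

  β = A * 1/ B
  βB≡A : β * B ≡ A
  βB≡A = trans (*-assoc A (1/ B) B) (trans (cong (A *_) (*-inverseˡ B)) (*-identityʳ A))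

  d∣linear : d ∣ₚ (- A ∷ B ∷ [])
  d∣linear = let s , eval-d·s = ∣ₚ-combination d p q u v d∣p d∣q in
    s , eval-agrees-from⇒≈ₚ 2 (d *ₚ s) (- A ∷ B ∷ []) λ n → let x = ℕ→ℚ (2 ℕ.+ n) in
      trans (eval-d·s x) (trans (combination x (ℕ→ℚ-1+m+n≢m 1 n)) (sym (eval-linear (- A) B x)))

  d[β]≡0 : eval d β ≡ 0ℚ
  d[β]≡0 = factor-of-linear-vanishes-at-root d (- A ∷ B ∷ []) β d-nonconstant d∣linear
    (λ { (suc (suc n)) _ → refl ; (suc zero) (s≤s ()) })
    (λ linear≈[] → B≢0 (linear≈[] 1))
    (trans (eval-linear (- A) B β) (trans (cong (- A +_) βB≡A) (+-inverseˡ A)))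

geometric-sum : ∀ k x → (x - 1ℚ) * eval (replicate k 1ℚ) x ≡ x ^ k - 1ℚ
geometric-sum zero    x = trans (*-zeroʳ (x - 1ℚ)) (sym (+-inverseʳ 1ℚ))
geometric-sum (suc k) x = begin
  (x - 1ℚ) * (1ℚ + x * S)        ≡⟨ regroup x S ⟩
  x - 1ℚ + x * ((x - 1ℚ) * S)    ≡⟨ cong (λ t → x - 1ℚ + x * t) (geometric-sum k x) ⟩
  x - 1ℚ + x * (x ^ k - 1ℚ)      ≡⟨ telescope x (x ^ k) ⟩
  x * x ^ k - 1ℚ                 ∎
  where
  open ≡-Reasoning
  S = eval (replicate k 1ℚ) x
  regroup : ∀ x S → (x - 1ℚ) * (1ℚ + x * S) ≡ x - 1ℚ + x * ((x - 1ℚ) * S)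
  regroup = solve-∀ ℚ-ring
  telescope : ∀ x y → x - 1ℚ + x * (y - 1ℚ) ≡ x * y - 1ℚ
  telescope = solve-∀ ℚ-ring

polyC-closed : ∀ k x → (x - 1ℚ) * eval (polyC k) x ≡ x ^ suc k - (x + x) + 1ℚ
polyC-closed k x = begin
  (x - 1ℚ) * (- 1ℚ + x * S)        ≡⟨ regroup x S ⟩
  1ℚ - x + x * ((x - 1ℚ) * S)      ≡⟨ cong (λ t → 1ℚ - x + x * t) (geometric-sum k x) ⟩
  1ℚ - x + x * (x ^ k - 1ℚ)        ≡⟨ telescope x (x ^ k) ⟩
  x * x ^ k - (x + x) + 1ℚ         ∎
  where
  open ≡-Reasoning
  S = eval (replicate k 1ℚ) x
  regroup : ∀ x S → (x - 1ℚ) * (- 1ℚ + x * S) ≡ 1ℚ - x + x * ((x - 1ℚ) * S)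
  regroup = solve-∀ ℚ-ring
  telescope : ∀ x y → 1ℚ - x + x * (y - 1ℚ) ≡ x * y - (x + x) + 1ℚ
  telescope = solve-∀ ℚ-ring

root-of-polyC : ∀ k β → eval (polyC k) β ≡ 0ℚ → β ^ suc k ≡ β + β - 1ℚ
root-of-polyC k β C[β]≡0 = x-y≡0⇒x≡y (begin
  β ^ suc k - (β + β - 1ℚ)     ≡⟨ regroup β (β ^ suc k) ⟩
  β ^ suc k - (β + β) + 1ℚ     ≡⟨ sym (polyC-closed k β) ⟩
  (β - 1ℚ) * eval (polyC k) β  ≡⟨ cong ((β - 1ℚ) *_) C[β]≡0 ⟩
  (β - 1ℚ) * 0ℚ                ≡⟨ *-zeroʳ (β - 1ℚ) ⟩
  0ℚ                           ∎)
  where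
  open ≡-Reasoning
  regroup : ∀ β y → y - (β + β - 1ℚ) ≡ y - (β + β) + 1ℚ
  regroup = solve-∀ ℚ-ring

ratio-root-of-polyC : ∀ k a b β → β * ℕ→ℚ b ≡ ℕ→ℚ a → eval (polyC k) β ≡ 0ℚ →
  a ℕ.^ suc k ℕ.+ b ℕ.^ suc k ≡ 2 ℕ.* a ℕ.* b ℕ.^ k
ratio-root-of-polyC k a b β βB≡A C[β]≡0 = ℕ→ℚ-injective (begin
  ℕ→ℚ (a ℕ.^ suc k ℕ.+ b ℕ.^ suc k)
    ≡⟨ trans (ℕ→ℚ-+ (a ℕ.^ suc k) (b ℕ.^ suc k)) (cong₂ _+_ (ℕ→ℚ-^ a (suc k)) (ℕ→ℚ-^ b (suc k))) ⟩
  A ^ suc k + B ^ suc k              ≡⟨ cong (λ t → t ^ suc k + B ^ suc k) (sym βB≡A) ⟩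
  (β * B) ^ suc k + B ^ suc k        ≡⟨ cong (_+ B ^ suc k) (^-distribʳ-* β B (suc k)) ⟩
  β ^ suc k * B ^ suc k + B ^ suc k  ≡⟨ cong (λ t → t * B ^ suc k + B ^ suc k) (root-of-polyC k β C[β]≡0) ⟩
  (β + β - 1ℚ) * (B * B ^ k) + B * B ^ k
                                     ≡⟨ regroup β B (B ^ k) ⟩
  (1ℚ + 1ℚ) * (β * B) * B ^ k        ≡⟨ cong (λ t → (1ℚ + 1ℚ) * t * B ^ k) βB≡A ⟩
  (1ℚ + 1ℚ) * A * B ^ k              ≡⟨ cong (λ t → t * A * B ^ k) (sym two) ⟩
  ℕ→ℚ 2 * A * B ^ k                  ≡⟨ cong (ℕ→ℚ 2 * A *_) (sym (ℕ→ℚ-^ b k)) ⟩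
  ℕ→ℚ 2 * A * ℕ→ℚ (b ℕ.^ k)          ≡⟨ cong (_* ℕ→ℚ (b ℕ.^ k)) (sym (ℕ→ℚ-* 2 a)) ⟩
  ℕ→ℚ (2 ℕ.* a) * ℕ→ℚ (b ℕ.^ k)      ≡⟨ sym (ℕ→ℚ-* (2 ℕ.* a) (b ℕ.^ k)) ⟩
  ℕ→ℚ (2 ℕ.* a ℕ.* b ℕ.^ k)         ∎)
  where
  open ≡-Reasoning
  A = ℕ→ℚ a
  B = ℕ→ℚ b
  two : ℕ→ℚ 2 ≡ 1ℚ + 1ℚ
  two = refl
  regroup : ∀ β B y → (β + β - 1ℚ) * (B * y) + B * y ≡ (1ℚ + 1ℚ) * (β * B) * y
  regroup = solve-∀ ℚ-ring

relPrime-polyC : ∀ k p u v a b →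
  (∀ x → x ≢ 1ℚ → eval u x * eval p x + eval v x * eval (polyC k) x ≡ - ℕ→ℚ a + x * ℕ→ℚ b) →
  b ≢ 0 → a ℕ.^ suc k ℕ.+ b ℕ.^ suc k ≢ 2 ℕ.* a ℕ.* b ℕ.^ k → RelPrime p (polyC k)
relPrime-polyC k p u v a b combination b≢0 no-solution d d-nonconstant d∣p d∣C =
  let β , βB≡A , C[β]≡0 = common-factor-root d p (polyC k) u v a b d-nonconstant d∣p d∣C b≢0 combination
  in  no-solution (ratio-root-of-polyC k a b β βB≡A C[β]≡0)

-- Closed forms and the two combinations

arithGeoClosed : ℚ → ℚ → ℕ → ℚ → ℚ
arithGeoClosed a b n x =
  (a + b * (ℕ→ℚ n - 1ℚ)) * x ^ suc n - (a + b * ℕ→ℚ n) * x ^ n + (b - a) * x + a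

arithmetico-geometric-sum : ∀ f a b n x → (∀ j → j < n → f j ≡ a + b * ℕ→ℚ j) →
  (x - 1ℚ) * (x - 1ℚ) * eval (applyUpTo f n) x ≡ arithGeoClosed a b n x
arithmetico-geometric-sum f a b zero    x _  = empty a b x
  where
  empty : ∀ a b x → (x - 1ℚ) * (x - 1ℚ) * 0ℚ
                  ≡ (a + b * (0ℚ - 1ℚ)) * (x * 1ℚ) - (a + b * 0ℚ) * 1ℚ + (b - a) * x + a
  empty = solve-∀ ℚ-ring
arithmetico-geometric-sum f a b (suc n) x f≡ = begin
  (x - 1ℚ) * (x - 1ℚ) * (f 0 + x * S)
    ≡⟨ cong (λ c → (x - 1ℚ) * (x - 1ℚ) * (c + x * S)) (f≡ 0 (s≤s z≤n)) ⟩
  (x - 1ℚ) * (x - 1ℚ) * (a + b * 0ℚ + x * S)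
    ≡⟨ regroup x (a + b * 0ℚ) S ⟩
  (x - 1ℚ) * (x - 1ℚ) * (a + b * 0ℚ) + x * ((x - 1ℚ) * (x - 1ℚ) * S)
    ≡⟨ cong (λ t → (x - 1ℚ) * (x - 1ℚ) * (a + b * 0ℚ) + x * t)
            (arithmetico-geometric-sum (f ∘ suc) (a + b) b n x f∘suc≡) ⟩
  (x - 1ℚ) * (x - 1ℚ) * (a + b * 0ℚ) + x * arithGeoClosed (a + b) b n x
    ≡⟨ peel a b x (x ^ n) (ℕ→ℚ n) (ℕ→ℚ-suc n) ⟩
  arithGeoClosed a b (suc n) x ∎
  where
  open ≡-Reasoning
  S = eval (applyUpTo (f ∘ suc) n) x

  f∘suc≡ : ∀ j → j < n → f (suc j) ≡ a + b + b * ℕ→ℚ j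
  f∘suc≡ j j<n =
    trans (f≡ (suc j) (s≤s j<n)) (trans (cong (λ t → a + b * t) (ℕ→ℚ-suc j)) (distrib a b (ℕ→ℚ j)))
    where
    distrib : ∀ a b J → a + b * (1ℚ + J) ≡ a + b + b * J
    distrib = solve-∀ ℚ-ring

  regroup : ∀ x c S → (x - 1ℚ) * (x - 1ℚ) * (c + x * S)
                    ≡ (x - 1ℚ) * (x - 1ℚ) * c + x * ((x - 1ℚ) * (x - 1ℚ) * S)
  regroup = solve-∀ ℚ-ring

  peel : ∀ {M} a b x y N → M ≡ 1ℚ + N →
    (x - 1ℚ) * (x - 1ℚ) * (a + b * 0ℚ)
      + x * ((a + b + b * (N - 1ℚ)) * (x * y) - (a + b + b * N) * y + (b - (a + b)) * x + (a + b))
    ≡ (a + b * (M - 1ℚ)) * (x * (x * y)) - (a + b * M) * (x * y) + (b - a) * x + a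
  peel a b x y N refl = solve (a ∷ b ∷ x ∷ y ∷ N ∷ []) ℚ-ring

polyA-closed : ∀ n x → (x - 1ℚ) * (x - 1ℚ) * eval (polyA (suc n)) x ≡ arithGeoClosed 1ℚ 1ℚ n x
polyA-closed n x =
  trans (cong (λ p → (x - 1ℚ) * (x - 1ℚ) * eval p x) (map-upTo (ℕ→ℚ ∘ suc) n))
        (arithmetico-geometric-sum (ℕ→ℚ ∘ suc) 1ℚ 1ℚ n x λ j _ →
          trans (ℕ→ℚ-suc j) (cong (1ℚ +_) (sym (*-identityˡ (ℕ→ℚ j)))))

reflected-index : ∀ n j → j ≤ suc n → 2 ℕ.* suc n ∸ (n ℕ.+ j) ∸ 1 ≡ suc n ∸ j
reflected-index n j j≤1+n = begin
  2 ℕ.* suc n ∸ (n ℕ.+ j) ∸ 1                      ≡⟨ ℕₚ.∸-+-assoc (2 ℕ.* suc n) (n ℕ.+ j) 1 ⟩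
  2 ℕ.* suc n ∸ (n ℕ.+ j ℕ.+ 1)                    ≡⟨ cong (_∸ (n ℕ.+ j ℕ.+ 1)) split ⟩
  n ℕ.+ j ℕ.+ 1 ℕ.+ (suc n ∸ j) ∸ (n ℕ.+ j ℕ.+ 1)  ≡⟨ ℕₚ.m+n∸m≡n (n ℕ.+ j ℕ.+ 1) (suc n ∸ j) ⟩
  suc n ∸ j                                        ∎
  where
  open ≡-Reasoning
  double : ∀ m → 2 ℕ.* m ≡ m ℕ.+ m
  double = ℕ-Solver.solve-∀
  regroup : ∀ n j r → suc n ℕ.+ (j ℕ.+ r) ≡ n ℕ.+ j ℕ.+ 1 ℕ.+ r
  regroup = ℕ-Solver.solve-∀
  split : 2 ℕ.* suc n ≡ n ℕ.+ j ℕ.+ 1 ℕ.+ (suc n ∸ j)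
  split = trans (double (suc n))
                (trans (cong (suc n ℕ.+_) (sym (ℕₚ.m+[n∸m]≡n j≤1+n))) (regroup n j (suc n ∸ j)))

polyB-closed : ∀ n x → (x - 1ℚ) * (x - 1ℚ) * eval (polyB (suc n)) x
  ≡ arithGeoClosed (1ℚ + 1ℚ) (1ℚ + 1ℚ) n x + x ^ n * arithGeoClosed (ℕ→ℚ (suc n)) (- 1ℚ) (suc n) x
polyB-closed n x = begin
  X * eval (map g₁ (upTo n) +ₚ shift n (map g₂ (upTo (suc n)))) x
    ≡⟨ cong (X *_) (trans (eval-+ₚ (map g₁ (upTo n)) (shift n (map g₂ (upTo (suc n)))) x)
                          (cong (eval (map g₁ (upTo n)) x +_) (eval-shift n (map g₂ (upTo (suc n))) x))) ⟩
  X * (eval (map g₁ (upTo n)) x + x ^ n * eval (map g₂ (upTo (suc n))) x)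
    ≡⟨ distrib X (eval (map g₁ (upTo n)) x) (x ^ n) (eval (map g₂ (upTo (suc n))) x) ⟩
  X * eval (map g₁ (upTo n)) x + x ^ n * (X * eval (map g₂ (upTo (suc n))) x)
    ≡⟨ cong₂ (λ s t → s + x ^ n * t)
         (trans (cong (λ p → X * eval p x) (map-upTo g₁ n))
                (arithmetico-geometric-sum g₁ (1ℚ + 1ℚ) (1ℚ + 1ℚ) n x λ i _ → g₁≡ i))
         (trans (cong (λ p → X * eval p x) (map-upTo g₂ (suc n)))
                (arithmetico-geometric-sum g₂ (ℕ→ℚ (suc n)) (- 1ℚ) (suc n) x g₂≡)) ⟩
  arithGeoClosed (1ℚ + 1ℚ) (1ℚ + 1ℚ) n x + x ^ n * arithGeoClosed (ℕ→ℚ (suc n)) (- 1ℚ) (suc n) x ∎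
  where
  open ≡-Reasoning
  X = (x - 1ℚ) * (x - 1ℚ)
  g₁ = λ i → ℕ→ℚ (2 ℕ.* i ℕ.+ 2)
  g₂ = λ j → ℕ→ℚ (2 ℕ.* suc n ∸ (n ℕ.+ j) ∸ 1)

  distrib : ∀ X u y v → X * (u + y * v) ≡ X * u + y * (X * v)
  distrib = solve-∀ ℚ-ring

  g₁≡ : ∀ i → g₁ i ≡ (1ℚ + 1ℚ) + (1ℚ + 1ℚ) * ℕ→ℚ i
  g₁≡ i = trans (ℕ→ℚ-+ (2 ℕ.* i) 2) (trans (cong (_+ ℕ→ℚ 2) (ℕ→ℚ-* 2 i)) (+-comm (ℕ→ℚ 2 * ℕ→ℚ i) (ℕ→ℚ 2)))

  g₂≡ : ∀ j → j < suc n → g₂ j ≡ ℕ→ℚ (suc n) + - 1ℚ * ℕ→ℚ j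
  g₂≡ j j<1+n = begin
    g₂ j                         ≡⟨ cong ℕ→ℚ (reflected-index n j (ℕₚ.<⇒≤ j<1+n)) ⟩
    ℕ→ℚ (suc n ∸ j)              ≡⟨ ℕ→ℚ-∸ (ℕₚ.<⇒≤ j<1+n) ⟩
    ℕ→ℚ (suc n) - ℕ→ℚ j          ≡⟨ minus-one (ℕ→ℚ (suc n)) (ℕ→ℚ j) ⟩
    ℕ→ℚ (suc n) + - 1ℚ * ℕ→ℚ j   ∎
    where
    minus-one : ∀ K J → K - J ≡ K + - 1ℚ * J
    minus-one = solve-∀ ℚ-ring

x²[x-1] : Poly
x²[x-1] = 0ℚ ∷ 0ℚ ∷ - 1ℚ ∷ 1ℚ ∷ []

cofactorA : ℕ → Poly
cofactorA k = ℕ→ℚ k ∷ 1ℚ - ℕ→ℚ k ∷ []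

cofactorB : ℕ → Poly
cofactorB k = ℕ→ℚ (suc k) ∷ 1ℚ - ℕ→ℚ k ∷ shift (k ∸ 1) (- 1ℚ ∷ [])

-- The first factor is eval x²[x-1] x unfolded, so that the solver can see it.
combination-times-x-1 : ∀ x P V C →
  (x - 1ℚ) * ((0ℚ + x * (0ℚ + x * (- 1ℚ + x * (1ℚ + x * 0ℚ)))) * P + V * C)
    ≡ x * x * ((x - 1ℚ) * (x - 1ℚ) * P) + V * ((x - 1ℚ) * C)
combination-times-x-1 = solve-∀ ℚ-ring

combination-A : ∀ n x → x ≢ 1ℚ →
  eval x²[x-1] x * eval (polyA (suc n)) x + eval (cofactorA (suc n)) x * eval (polyC (suc n)) x
    ≡ - ℕ→ℚ (suc n) + x * ℕ→ℚ (suc n ℕ.+ n)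
combination-A n x x≢1 = *-cancelˡ-≢0 (x≢1 ∘ x-y≡0⇒x≡y) (begin
  (x - 1ℚ) * (eval x²[x-1] x * A + v * C)
    ≡⟨ combination-times-x-1 x A v C ⟩
  x * x * ((x - 1ℚ) * (x - 1ℚ) * A) + v * ((x - 1ℚ) * C)
    ≡⟨ cong₂ (λ s t → x * x * s + v * t) (polyA-closed n x) (polyC-closed (suc n) x) ⟩
  x * x * arithGeoClosed 1ℚ 1ℚ n x + v * (x ^ suc (suc n) - (x + x) + 1ℚ)
    ≡⟨ identity x (x ^ n) (ℕ→ℚ n) (ℕ→ℚ-suc n) (ℕ→ℚ-+ (suc n) n) ⟩
  (x - 1ℚ) * (- ℕ→ℚ (suc n) + x * ℕ→ℚ (suc n ℕ.+ n)) ∎)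
  where
  open ≡-Reasoning
  A = eval (polyA (suc n)) x
  C = eval (polyC (suc n)) x
  v = eval (cofactorA (suc n)) x
  identity : ∀ {K U} x y N → K ≡ 1ℚ + N → U ≡ K + N →
    x * x * ((1ℚ + 1ℚ * (N - 1ℚ)) * (x * y) - (1ℚ + 1ℚ * N) * y + (1ℚ - 1ℚ) * x + 1ℚ)
      + (K + x * (1ℚ - K + x * 0ℚ)) * (x * (x * y) - (x + x) + 1ℚ)
    ≡ (x - 1ℚ) * (- K + x * U)
  identity x y N refl refl = solve (x ∷ y ∷ N ∷ []) ℚ-ring

combination-B : ∀ n x → x ≢ 1ℚ →
  eval x²[x-1] x * eval (polyB (suc n)) x + eval (cofactorB (suc n)) x * eval (polyC (suc n)) x
    ≡ - ℕ→ℚ (suc (suc n)) + x * ℕ→ℚ (suc n ℕ.+ suc n)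
combination-B n x x≢1 = *-cancelˡ-≢0 (x≢1 ∘ x-y≡0⇒x≡y) (begin
  (x - 1ℚ) * (eval x²[x-1] x * B + v * C)
    ≡⟨ combination-times-x-1 x B v C ⟩
  x * x * ((x - 1ℚ) * (x - 1ℚ) * B) + v * ((x - 1ℚ) * C)
    ≡⟨ cong₂ (λ s t → x * x * s + v * t) (polyB-closed n x) (polyC-closed (suc n) x) ⟩
  x * x * B-closed + v * C-closed
    ≡⟨ cong (λ e → x * x * B-closed + (ℕ→ℚ (suc (suc n)) + x * (1ℚ - K + x * e)) * C-closed)
            (eval-shift n (- 1ℚ ∷ []) x) ⟩
  x * x * B-closed + (ℕ→ℚ (suc (suc n)) + x * (1ℚ - K + x * (x ^ n * (- 1ℚ + x * 0ℚ)))) * C-closed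
    ≡⟨ identity x (x ^ n) (ℕ→ℚ n) (ℕ→ℚ-suc n) (ℕ→ℚ-suc (suc n)) (ℕ→ℚ-+ (suc n) (suc n)) ⟩
  (x - 1ℚ) * (- ℕ→ℚ (suc (suc n)) + x * ℕ→ℚ (suc n ℕ.+ suc n)) ∎)
  where
  open ≡-Reasoning
  K = ℕ→ℚ (suc n)
  B = eval (polyB (suc n)) x
  C = eval (polyC (suc n)) x
  v = eval (cofactorB (suc n)) x
  B-closed = arithGeoClosed (1ℚ + 1ℚ) (1ℚ + 1ℚ) n x + x ^ n * arithGeoClosed K (- 1ℚ) (suc n) x
  C-closed = x ^ suc (suc n) - (x + x) + 1ℚ
  identity : ∀ {K W V} x y N → K ≡ 1ℚ + N → W ≡ 1ℚ + K → V ≡ K + K →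
    x * x * (((1ℚ + 1ℚ) + (1ℚ + 1ℚ) * (N - 1ℚ)) * (x * y) - ((1ℚ + 1ℚ) + (1ℚ + 1ℚ) * N) * y
               + ((1ℚ + 1ℚ) - (1ℚ + 1ℚ)) * x + (1ℚ + 1ℚ)
             + y * ((K + - 1ℚ * (K - 1ℚ)) * (x * (x * y)) - (K + - 1ℚ * K) * (x * y)
                    + (- 1ℚ - K) * x + K))
      + (W + x * (1ℚ - K + x * (y * (- 1ℚ + x * 0ℚ)))) * (x * (x * y) - (x + x) + 1ℚ)
    ≡ (x - 1ℚ) * (- W + x * V)
  identity x y N refl refl refl = solve (x ∷ y ∷ N ∷ []) ℚ-ring

-- The equation aᵏ⁺¹ + bᵏ⁺¹ = 2abᵏ in ℕ

coprime-suc : ∀ n → Coprime n (suc n)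
coprime-suc n = subst (Coprime n) (ℕₚ.+-comm n 1) (Coprime.sym (coprime-+ (1-coprimeTo n)))

coprime-∣^⇒≡1 : ∀ {m a} n → Coprime m a → m ∣ a ℕ.^ n → m ≡ 1
coprime-∣^⇒≡1 zero    _        m∣1    = ∣1⇒≡1 m∣1
coprime-∣^⇒≡1 (suc n) coprime m∣aⁿ⁺¹ = coprime-∣^⇒≡1 n coprime (coprime-divisor coprime m∣aⁿ⁺¹)

∣a⇒∣bᵏ⁺¹ : ∀ {m a b} k → a ℕ.^ suc k ℕ.+ b ℕ.^ suc k ≡ 2 ℕ.* a ℕ.* b ℕ.^ k →
  m ∣ a → m ∣ b ℕ.^ suc k
∣a⇒∣bᵏ⁺¹ {m} {a} {b} k eq m∣a = ∣m+n∣m⇒∣n (subst (m ∣_) (sym eq) m∣2abᵏ) m∣aᵏ⁺¹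
  where
  m∣aᵏ⁺¹ : m ∣ a ℕ.^ suc k
  m∣aᵏ⁺¹ = ∣-trans m∣a (m∣m*n (a ℕ.^ k))
  m∣2abᵏ : m ∣ 2 ℕ.* a ℕ.* b ℕ.^ k
  m∣2abᵏ = ∣-trans m∣a (∣-trans (n∣m*n 2) (m∣m*n (b ℕ.^ k)))

∣b⇒∣aᵏ⁺² : ∀ {m a b} k → a ℕ.^ suc (suc k) ℕ.+ b ℕ.^ suc (suc k) ≡ 2 ℕ.* a ℕ.* b ℕ.^ suc k →
  m ∣ b → m ∣ a ℕ.^ suc (suc k)
∣b⇒∣aᵏ⁺² {m} {a} {b} k eq m∣b =
  ∣m+n∣m⇒∣n (subst (m ∣_) (trans (sym eq) (ℕₚ.+-comm aᵏ⁺² (b ℕ.^ suc (suc k)))) m∣2abᵏ⁺¹) m∣bᵏ⁺²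
  where
  aᵏ⁺² = a ℕ.^ suc (suc k)
  m∣bᵏ⁺² : m ∣ b ℕ.^ suc (suc k)
  m∣bᵏ⁺² = ∣-trans m∣b (m∣m*n (b ℕ.^ suc k))
  m∣2abᵏ⁺¹ : m ∣ 2 ℕ.* a ℕ.* b ℕ.^ suc k
  m∣2abᵏ⁺¹ = ∣-trans m∣b (∣-trans (m∣m*n (b ℕ.^ k)) (n∣m*n (2 ℕ.* a)))

no-power-sum-A : ∀ m → let k = suc (suc m) in
  k ℕ.^ suc k ℕ.+ (k ℕ.+ suc m) ℕ.^ suc k ≢ 2 ℕ.* k ℕ.* (k ℕ.+ suc m) ℕ.^ k
no-power-sum-A m eq with coprime-∣^⇒≡1 (suc (suc (suc m)))
  (Coprime.sym (coprime-+ (coprime-suc (suc m)))) (∣a⇒∣bᵏ⁺¹ (suc (suc m)) eq ∣-refl)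
... | ()

no-power-sum-B : ∀ m → let k = suc (suc m) in
  suc k ℕ.^ suc k ℕ.+ (k ℕ.+ k) ℕ.^ suc k ≢ 2 ℕ.* suc k ℕ.* (k ℕ.+ k) ℕ.^ k
no-power-sum-B m eq with coprime-∣^⇒≡1 (suc (suc (suc m)))
  (coprime-suc (suc (suc m))) (∣b⇒∣aᵏ⁺² (suc m) eq (∣m∣n⇒∣m+n ∣-refl ∣-refl))
... | ()

lemma1 : (k : ℕ) → 2 ≤ k → RelPrime (polyA k) (polyC k) × RelPrime (polyB k) (polyC k)
lemma1 (suc zero)    (s≤s ())
lemma1 (suc (suc m)) _ =
    relPrime-polyC k (polyA k) x²[x-1] (cofactorA k) k (k ℕ.+ suc m)
      (combination-A (suc m)) (λ ()) (no-power-sum-A m)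
  , relPrime-polyC k (polyB k) x²[x-1] (cofactorB k) (suc k) (k ℕ.+ k)
      (combination-B (suc m)) (λ ()) (no-power-sum-B m)
  where k = suc (suc m)
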